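{- Let $s,t\in\{0,1,2,\dots\}$ and $c\in\mathbb{Z}^l$, and suppose $s$ divides $t$ (i.e. $t=ns$ for some integer $n$; this includes $t=0$). Then $\mathcal{C}_{(s|c)}\subseteq\mathcal{C}_{(t|c)}$.
   Context: An $l$-multipartition is an $l$-tuple of partitions, with nodes $(a,b,k)$ for $b\le\lambda^{(k)}_a$. The $(s\,|\,c)$-residue of $(a,b,k)$ is $b-a+c_k+s\mathbb{Z}$ (the integer $b-a+c_k$ if $s=0$); the $(s\,|\,c)$-content is the multiset of residues of the nodes; $\lambda$ is an $(s\,|\,c)$-core if no other $l$-multipartition has the same content, except that for $s=1$ the set of $(1\,|\,c)$-cores is $\{(\varnothing,\dots,\varnothing)\}$. $\mathcal{C}_{(s|c)}$ is the set of $(s\,|\,c)$-cores. -}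

module Defs where

open import Data.Nat as ℕ using (ℕ; zero; suc; _<_)
open import Data.Integer as ℤ using (ℤ; +_; _+_; _-_)
open import Data.Integer.DivMod using (_%ℕ_)
open import Data.List using (List; []; _∷_; _++_; map; upTo)
open import Data.List.Relation.Unary.All using (All)
open import Data.List.Relation.Unary.Linked using (Linked)
open import Data.List.Relation.Binary.Permutation.Propositional using (_↭_)
open import Data.Vec as Vec using (Vec; []; _∷_)
open import Relation.Binary.PropositionalEquality using (_≡_)

record Partition : Set where
  constructor mkPartition
  field
    parts : List ℕ
    decr  : Linked ℕ._≥_ parts
    pos   : All (0 <_) parts
open Partition public

Multipartition : ℕ → Set
Multipartition l = Vec Partition l

-- underlying data (used for equality of multipartitions)
shape : ∀ {l} → Multipartition l → Vec (List ℕ) l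
shape = Vec.map parts

rowRes : ℤ → ℕ → ℕ → List ℤ
rowRes ck a m = map (λ b → + b - + a + ck) (map suc (upTo m))

partResFrom : ℤ → ℕ → List ℕ → List ℤ
partResFrom ck a [] = []
partResFrom ck a (m ∷ ms) = rowRes ck a m ++ partResFrom ck (suc a) ms

-- list (with multiplicity) of the integers b - a + c_k over all nodes (a,b,k)
nodeInts : ∀ {l} → Vec ℤ l → Multipartition l → List ℤ
nodeInts [] [] = []
nodeInts (ck ∷ c) (p ∷ λs) = partResFrom ck 1 (parts p) ++ nodeInts c λs

-- canonical representative of x + sℤ (x itself if s = 0)
res : ℕ → ℤ → ℤ
res zero x = x
res (suc n) x = + (x %ℕ suc n)

-- (s|c)-content as a list of residues; contents are equal as multisets iff
-- these lists are permutations of each other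
content : ∀ {l} → ℕ → Vec ℤ l → Multipartition l → List ℤ
content s c λ′ = map (res s) (nodeInts c λ′)

SameContent : ∀ {l} → ℕ → Vec ℤ l → Multipartition l → Multipartition l → Set
SameContent s c λ′ μ = content s c λ′ ↭ content s c μ

AllEmpty : ∀ {l} → Multipartition l → Set
AllEmpty {l} λ′ = shape λ′ ≡ Vec.replicate l []

-- λ is an (s|c)-core; for s = 1 the cores are exactly the empty multipartition
IsCore : ∀ {l} → ℕ → Vec ℤ l → Multipartition l → Set
IsCore (suc zero) c λ′ = AllEmpty λ′
IsCore s c λ′ = ∀ μ → SameContent s c λ′ μ → shape μ ≡ shape λ′

-- Since s ∣ t, reduction modulo s factors through reduction modulo t, so the
-- (s|c)-content of a multipartition is the image of its (t|c)-content; equal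
-- (t|c)-contents therefore give equal (s|c)-contents, and uniqueness of the
-- (s|c)-content passes to the (t|c)-content. For s = 1 the only core is the
-- empty multipartition, whose content is empty for every t; since parts are
-- positive, only the empty multipartition has empty content.
module Submission where

open import Defs
open import Data.Nat using (ℕ)
open import Data.Nat.Divisibility using (_∣_)
open import Data.Integer using (ℤ)
open import Data.Vec using (Vec)

open import Data.Nat
  using (zero; suc; _+_; _*_; _∸_; _%_; _/_; _≤_; NonZero; z≤n; s≤s)
open import Data.Nat.Properties
  using (≤-trans; +-comm; +-∸-comm; ∸-+-assoc; m∸n≤m; m∸n+n≡m; m+n≤o⇒m≤o∸n)
open import Data.Nat.DivMod
  using ( m≡m%n+[m/n]*n; [m+kn]%n≡m%n; n%n≡0; m%n≤n; m%n≤m; m<n⇒m%n≡m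
        ; m∣n⇒o%n%m≡o%m)
open import Data.Nat.Divisibility using (divides-refl; 0∣⇒≡0; ∣1⇒≡1)
open import Data.Integer using (+_; -[1+_]; _%ℕ_)
open import Data.List using (List; []; _∷_; map)
open import Data.List.Properties using (map-∘; map-cong; ++-conicalˡ; ++-conicalʳ)
open import Data.List.Relation.Binary.Permutation.Propositional using (_↭_; ↭-sym)
open import Data.List.Relation.Binary.Permutation.Propositional.Properties
  using (↭-empty-inv; map⁺)
open import Data.List.Relation.Unary.All using (_∷_)
open import Data.Vec using ([]; _∷_; tail)
open import Function using (_∘_)
open import Relation.Binary.PropositionalEquality
  using (_≡_; refl; sym; trans; cong; cong₂; subst; subst₂; _≗_; module ≡-Reasoning)

[t∸r]%d≡[d∸r]%d : ∀ {d t r} .{{_ : NonZero d}} → d ∣ t → r ≤ d → r ≤ t →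
                  (t ∸ r) % d ≡ (d ∸ r) % d
[t∸r]%d≡[d∸r]%d {d@(suc _)} (divides-refl zero) _ z≤n = sym (n%n≡0 d)
[t∸r]%d≡[d∸r]%d {d} {r = r} (divides-refl (suc p)) r≤d _ =
  trans (cong (_% d) (+-∸-comm (p * d) r≤d)) ([m+kn]%n≡m%n (d ∸ r) p d)

[t∸m]%d≡[d∸m%d]%d : ∀ {d t} m .{{_ : NonZero d}} → d ∣ t → m ≤ t →
                    (t ∸ m) % d ≡ (d ∸ m % d) % d
[t∸m]%d≡[d∸m%d]%d {d} {t} m d∣t m≤t = begin
  (t ∸ m) % d          ≡⟨ [m+kn]%n≡m%n (t ∸ m) q d ⟨
  (t ∸ m + q * d) % d  ≡⟨ cong (_% d) t∸m+qd≡t∸r ⟩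
  (t ∸ r) % d          ≡⟨ [t∸r]%d≡[d∸r]%d d∣t (m%n≤n m d) (≤-trans (m%n≤m m d) m≤t) ⟩
  (d ∸ r) % d          ∎
  where
  open ≡-Reasoning
  r = m % d
  q = m / d
  qd≤t∸r : q * d ≤ t ∸ r
  qd≤t∸r = m+n≤o⇒m≤o∸n (q * d)
    (subst (_≤ t) (trans (m≡m%n+[m/n]*n m d) (+-comm r (q * d))) m≤t)
  t∸m+qd≡t∸r : t ∸ m + q * d ≡ t ∸ r
  t∸m+qd≡t∸r = begin
    t ∸ m + q * d            ≡⟨ cong (λ x → t ∸ x + q * d) (m≡m%n+[m/n]*n m d) ⟩
    t ∸ (r + q * d) + q * d  ≡⟨ cong (_+ q * d) (∸-+-assoc t r (q * d)) ⟨
    t ∸ r ∸ q * d + q * d    ≡⟨ m∸n+n≡m qd≤t∸r ⟩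
    t ∸ r                    ∎

-[1+n]%ℕd≡[d∸[1+n]%d]%d : ∀ n d .{{_ : NonZero d}} →
                          -[1+ n ] %ℕ d ≡ (d ∸ suc n % d) % d
-[1+n]%ℕd≡[d∸[1+n]%d]%d n d@(suc d′) with suc n % d
... | zero  = sym (n%n≡0 d)
... | suc r = sym (m<n⇒m%n≡m (s≤s (m∸n≤m d′ r)))

∣⇒res∘res≗res : ∀ {s t} → s ∣ t → res s ∘ res t ≗ res s
∣⇒res∘res≗res {t = zero} _ x = refl
∣⇒res∘res≗res {zero} {suc t} s∣t x with () ← 0∣⇒≡0 s∣t
∣⇒res∘res≗res {s@(suc _)} {t@(suc _)} s∣t (+ n) = cong +_ (m∣n⇒o%n%m≡o%m s t n s∣t)
∣⇒res∘res≗res {s@(suc _)} {t@(suc _)} s∣t -[1+ n ] = cong +_ (begin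
  (-[1+ n ] %ℕ t) % s      ≡⟨ cong (_% s) (-[1+n]%ℕd≡[d∸[1+n]%d]%d n t) ⟩
  (t ∸ suc n % t) % t % s  ≡⟨ m∣n⇒o%n%m≡o%m s t (t ∸ suc n % t) s∣t ⟩
  (t ∸ suc n % t) % s      ≡⟨ [t∸m]%d≡[d∸m%d]%d (suc n % t) s∣t (m%n≤n (suc n) t) ⟩
  (s ∸ suc n % t % s) % s  ≡⟨ cong (λ r → (s ∸ r) % s) (m∣n⇒o%n%m≡o%m s t (suc n) s∣t) ⟩
  (s ∸ suc n % s) % s      ≡⟨ -[1+n]%ℕd≡[d∸[1+n]%d]%d n s ⟨
  -[1+ n ] %ℕ s            ∎)
  where open ≡-Reasoning

map-res-content : ∀ {l s t} → s ∣ t → (c : Vec ℤ l) (λ′ : Multipartition l) →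
                  map (res s) (content t c λ′) ≡ content s c λ′
map-res-content s∣t c λ′ =
  trans (sym (map-∘ (nodeInts c λ′))) (map-cong (∣⇒res∘res≗res s∣t) (nodeInts c λ′))

sameContent-∣ : ∀ {l s t} → s ∣ t → (c : Vec ℤ l) {λ′ μ : Multipartition l} →
                SameContent t c λ′ μ → SameContent s c λ′ μ
sameContent-∣ {s = s} s∣t c {λ′} {μ} same =
  subst₂ _↭_ (map-res-content s∣t c λ′) (map-res-content s∣t c μ) (map⁺ (res s) same)

-- IsCore s for s ≠ 1.
HasUniqueContent : ∀ {l} → ℕ → Vec ℤ l → Multipartition l → Set
HasUniqueContent s c λ′ = ∀ μ → SameContent s c λ′ μ → shape μ ≡ shape λ′

hasUniqueContent-∣ : ∀ {l s t} → s ∣ t → (c : Vec ℤ l) (λ′ : Multipartition l) →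
                     HasUniqueContent s c λ′ → HasUniqueContent t c λ′
hasUniqueContent-∣ s∣t c λ′ unique μ same = unique μ (sameContent-∣ s∣t c same)

allEmpty⇒nodeInts≡[] : ∀ {l} (c : Vec ℤ l) (λ′ : Multipartition l) →
                       AllEmpty λ′ → nodeInts c λ′ ≡ []
allEmpty⇒nodeInts≡[] []      []                         _     = refl
allEmpty⇒nodeInts≡[] (_ ∷ c) (mkPartition [] _ _ ∷ λ′) empty =
  allEmpty⇒nodeInts≡[] c λ′ (cong tail empty)

partResFrom≡[]⇒parts≡[] : ∀ ck a (p : Partition) →
                          partResFrom ck a (parts p) ≡ [] → parts p ≡ []
partResFrom≡[]⇒parts≡[] _ _ (mkPartition []          _ _)       _  = refl
partResFrom≡[]⇒parts≡[] _ _ (mkPartition (suc _ ∷ _) _ (_ ∷ _)) ()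

nodeInts≡[]⇒allEmpty : ∀ {l} (c : Vec ℤ l) (μ : Multipartition l) →
                       nodeInts c μ ≡ [] → AllEmpty μ
nodeInts≡[]⇒allEmpty []       []      _     = refl
nodeInts≡[]⇒allEmpty (ck ∷ c) (p ∷ μ) empty =
  cong₂ _∷_ (partResFrom≡[]⇒parts≡[] ck 1 p (++-conicalˡ _ _ empty))
            (nodeInts≡[]⇒allEmpty c μ (++-conicalʳ _ _ empty))

map≡[]⇒≡[] : ∀ {A B : Set} (f : A → B) (xs : List A) → map f xs ≡ [] → xs ≡ []
map≡[]⇒≡[] f [] _ = refl

allEmpty⇒hasUniqueContent : ∀ {l} t (c : Vec ℤ l) (λ′ : Multipartition l) →
                            AllEmpty λ′ → HasUniqueContent t c λ′
allEmpty⇒hasUniqueContent t c λ′ empty μ same =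
  trans (nodeInts≡[]⇒allEmpty c μ nodeInts-μ≡[]) (sym empty)
  where
  content-λ≡[] : content t c λ′ ≡ []
  content-λ≡[] = cong (map (res t)) (allEmpty⇒nodeInts≡[] c λ′ empty)
  nodeInts-μ≡[] : nodeInts c μ ≡ []
  nodeInts-μ≡[] = map≡[]⇒≡[] (res t) (nodeInts c μ)
    (↭-empty-inv (↭-sym (subst (_↭ content t c μ) content-λ≡[] same)))

lemma3p1 : (l s t : ℕ) (c : Vec ℤ l) → s ∣ t →
    (λ′ : Multipartition l) → IsCore s c λ′ → IsCore t c λ′
lemma3p1 l zero t c s∣t λ′ core with refl ← 0∣⇒≡0 s∣t = core
lemma3p1 l 1 1 c s∣t λ′ core = core
lemma3p1 l 1 zero c s∣t λ′ core = allEmpty⇒hasUniqueContent zero c λ′ core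
lemma3p1 l 1 (suc (suc t)) c s∣t λ′ core = allEmpty⇒hasUniqueContent (suc (suc t)) c λ′ core
lemma3p1 l (suc (suc s)) 1 c s∣t λ′ core with () ← ∣1⇒≡1 s∣t
lemma3p1 l (suc (suc s)) zero c s∣t λ′ core = hasUniqueContent-∣ s∣t c λ′ core
lemma3p1 l (suc (suc s)) (suc (suc t)) c s∣t λ′ core = hasUniqueContent-∣ s∣t c λ′ core
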